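{- Let $m\ge 3$ and let $A$ be an $\mathrm{OA}(m,(m-1)^2)$. Assume that $A$ contains a set $S$ of $(m-1)^2-1$ columns such that, for some sets $S_r$ of $m-1$ symbols ($r=1,\dots,m$) and some column vector $C$ with $C_r\in S_r$, the columns of $S$ together with $C$ form an $\mathrm{OA}(m,m-1)$ on the symbol sets $S_r$, and assume that $C$ is not a column of $A$. Then $A$ does not have the MMS star property.
   Context: An orthogonal array $\mathrm{OA}(m,n)$ is an $m\times n^2$ array with entries in an $n$-symbol alphabet such that for any two rows, each ordered pair of symbols occurs in exactly one column; "an $\mathrm{OA}(m,m-1)$ on symbol sets $S_r$" means an $m\times(m-1)^2$ array with row-$r$ entries in $S_r$ such that for any two rows $r\ne r'$ each pair in $S_r\times S_{r'}$ occurs in exactly one column. $A$ is viewed as an incidence structure with points the pairs $(r,i)$ and lines the columns, a column containing $(r,i)$ iff its row-$r$ entry is $i$; each point lies in $n$ columns. $A$ has the MMS star property if for every function $f$ from the points to $\mathbb{R}$ with total sum $0$, the number of columns whose points have nonnegative total weight is at least $n$. -}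

module Defs where

open import Data.Nat using (ℕ; zero; suc; _+_; _*_; _∸_; _≤_)
open import Data.Fin using (Fin; zero; suc)
open import Data.Fin.Subset using (Subset; _∈_; ∣_∣)
open import Data.Product using (_×_; ∃!; Σ)
open import Data.Sum using (_⊎_; inj₁; inj₂)
open import Data.Unit using (⊤; tt)
open import Data.Rational using (ℚ; 0ℚ) renaming (_+_ to _+ℚ_; _≤_ to _≤ℚ_)
open import Data.Rational.Properties using () renaming (_≤?_ to _≤ℚ?_)
open import Relation.Nullary using (¬_; Dec; yes; no)
open import Relation.Binary.PropositionalEquality using (_≡_; _≢_)

sumℚ : (k : ℕ) → (Fin k → ℚ) → ℚ
sumℚ zero    g = 0ℚ
sumℚ (suc k) g = g zero +ℚ sumℚ k (λ i → g (suc i))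

count : (k : ℕ) {P : Fin k → Set} → ((i : Fin k) → Dec (P i)) → ℕ
count zero    d = 0
count (suc k) d with d zero
... | yes _ = suc (count k (λ i → d (suc i)))
... | no  _ = count k (λ i → d (suc i))

IsOAOn : (m k : ℕ) (I : Set) → (I → Fin m → Fin k) → (Fin m → Fin k → Set) → Set
IsOAOn m k I col Sym =
  (∀ i r → Sym r (col i r)) ×
  (∀ r r' → r ≢ r' → ∀ a b → Sym r a → Sym r' b →
     ∃! _≡_ (λ i → col i r ≡ a × col i r' ≡ b))

-- OA(m,n): an m × n² array over Fin n (columns indexed by Fin (n * n)).
IsOA : (m n : ℕ) → (Fin (n * n) → Fin m → Fin n) → Set
IsOA m n A = IsOAOn m n (Fin (n * n)) A (λ _ _ → ⊤)

colWeight : {m n N : ℕ} → (Fin N → Fin m → Fin n) → (Fin m → Fin n → ℚ) → Fin N → ℚ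
colWeight {m} A f c = sumℚ m (λ r → f r (A c r))

totalWeight : (m n : ℕ) → (Fin m → Fin n → ℚ) → ℚ
totalWeight m n f = sumℚ m (λ r → sumℚ n (λ i → f r i))

MMSStar : (m n N : ℕ) → (Fin N → Fin m → Fin n) → Set
MMSStar m n N A =
  (f : Fin m → Fin n → ℚ) → totalWeight m n f ≡ 0ℚ →
  n ≤ count N (λ c → 0ℚ ≤ℚ? colWeight A f c)

module Submission where

-- Let m = p + 1 ≥ 3 and n = p².  We refute the MMS star property with one
-- weighting of total weight 0 under which fewer than n columns of A are
-- nonnegative.  With q = p, the point (r , i) weighs wOut = -(q² - q + 1) if
-- i ∉ S_r, wS = wOut + q³ if i ∈ S_r \ {C_r}, and wC = wOut + q² if i = C_r;
-- each row sums to n·wOut + (p - 1)·q³ + q² = 0.  Key fact: a column of A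
-- other than the p² - 1 columns σ j with entries in S_r and S_r' for two
-- distinct rows agrees with C in row r, since that pair is covered in the
-- small OA, and not by some σ j (two columns of an OA sharing two entries
-- coincide).  So such a column has either exactly one entry in the S_r, or
-- only C-entries there and, as C is not a column of A, one entry outside;
-- either way it weighs at most -1, and only the σ j can be nonnegative.

open import Defs
open import Data.Nat using (ℕ; _*_; _∸_; _≤_; suc)
open import Data.Fin using (Fin)
open import Data.Fin.Subset using (Subset; _∈_; ∣_∣)
open import Data.Sum using (_⊎_; [_,_])
open import Data.Unit using (⊤)
open import Function using (Injective; _∘_; const)
open import Relation.Nullary using (¬_)
open import Relation.Binary.PropositionalEquality using (_≡_)

open import Algebra.Bundles using (CommutativeRing)
open import Data.Bool using (if_then_else_)
open import Data.Empty using (⊥-elim)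
open import Data.Integer using (+≤+)
open import Data.Fin using (zero; suc; toℕ; punchIn; punchOut; _≟_)
open import Data.Fin.Properties using (any?; ¬∀⟶∃¬; punchIn-punchOut; suc-injective)
open import Data.Fin.Subset using (inside; outside; ⁅_⁆)
open import Data.Fin.Subset.Properties using (_∈?_; x∈⁅x⁆; x∈⁅y⁆⇒x≡y; ∣⁅x⁆∣≡1)
open import Data.Nat using (zero; z≤n; s≤s; pred)
open import Data.Nat.Properties using (0≢1+n; <-irrefl)
  renaming (≤-trans to ≤ℕ-trans)
open import Data.Product using (∃; _,_; proj₁; proj₂)
open import Data.Rational using (ℚ; 0ℚ; 1ℚ; -_; *≤*)
  renaming (_+_ to _+ℚ_; _*_ to _*ℚ_; _≤_ to _≤ℚ_)
open import Data.Rational.Properties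
  using (+-identityˡ; +-identityʳ; +-mono-≤; ≤-refl; ≤-trans; ≤-reflexive; *-identityˡ; +-*-commutativeRing)
  renaming (_≤?_ to _≤ℚ?_)
open import Data.Rational.Solver using (module +-*-Solver)
open import Data.Sum using (inj₁; inj₂)
open import Data.Unit using (tt)
open import Data.Vec using ([]; _∷_; here; there)
open import Relation.Nullary using (Dec; yes; no; contradiction)
open import Relation.Binary.PropositionalEquality using (_≢_; refl; sym; trans; cong; cong₂; subst)

-- k · x  is the k-fold sum  x + ⋯ + x  in ℚ.
open import Algebra.Properties.Semiring.Mult (CommutativeRing.semiring +-*-commutativeRing)
  using (×-assoc-*; ×1-homo-*) renaming (_×_ to _·_)
open +-*-Solver using (solve; _:=_; _:+_; _:*_; :-_; con)

·-as-* : ∀ k x → k · x ≡ (k · 1ℚ) *ℚ x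
·-as-* k x = sym (trans (×-assoc-* k 1ℚ x) (cong (k ·_) (*-identityˡ x)))

·1-nonneg : ∀ k → 0ℚ ≤ℚ k · 1ℚ
·1-nonneg zero    = ≤-refl
·1-nonneg (suc k) = subst (_≤ℚ suc k · 1ℚ) (+-identityʳ 0ℚ) (+-mono-≤ 0≤1 (·1-nonneg k))
  where
  0≤1 : 0ℚ ≤ℚ 1ℚ
  0≤1 = *≤* (+≤+ z≤n)

0≰-1 : ¬ (0ℚ ≤ℚ - 1ℚ)
0≰-1 (*≤* ())

sum-zero : ∀ k {g : Fin k → ℚ} → (∀ i → g i ≡ 0ℚ) → sumℚ k g ≡ 0ℚ
sum-zero zero    g≡0 = refl
sum-zero (suc k) g≡0 = trans (cong₂ _+ℚ_ (g≡0 zero) (sum-zero k (g≡0 ∘ suc))) (+-identityʳ 0ℚ)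

sum-+ : ∀ k (g h : Fin k → ℚ) → sumℚ k (λ i → g i +ℚ h i) ≡ sumℚ k g +ℚ sumℚ k h
sum-+ zero    g h = sym (+-identityʳ 0ℚ)
sum-+ (suc k) g h =
  trans (cong ((g zero +ℚ h zero) +ℚ_) (sum-+ k (g ∘ suc) (h ∘ suc)))
        (solve 4 (λ a b c d → (a :+ b) :+ (c :+ d) := (a :+ c) :+ (b :+ d)) refl
          (g zero) (h zero) (sumℚ k (g ∘ suc)) (sumℚ k (h ∘ suc)))

sum-const : ∀ k x → sumℚ k (const x) ≡ k · x
sum-const zero    x = refl
sum-const (suc k) x = cong (x +ℚ_) (sum-const k x)

sum-≤-const : ∀ k {g : Fin k → ℚ} {b} → (∀ i → g i ≤ℚ b) → sumℚ k g ≤ℚ k · b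
sum-≤-const zero    g≤b = ≤-refl
sum-≤-const (suc k) g≤b = +-mono-≤ (g≤b zero) (sum-≤-const k (g≤b ∘ suc))

sum-≤-except : ∀ k (g : Fin (suc k) → ℚ) r₀ {a b} →
               g r₀ ≤ℚ a → (∀ r → r ≢ r₀ → g r ≤ℚ b) → sumℚ (suc k) g ≤ℚ a +ℚ k · b
sum-≤-except k g zero g₀≤a g≤b =
  +-mono-≤ g₀≤a (sum-≤-const k (λ i → g≤b (suc i) λ ()))
sum-≤-except (suc k) g (suc r₀) {a} {b} g₀≤a g≤b =
  subst (sumℚ (suc (suc k)) g ≤ℚ_) (solve 3 (λ a b s → b :+ (a :+ s) := a :+ (b :+ s)) refl a b (k · b))
    (+-mono-≤ (g≤b zero λ ())
              (sum-≤-except k (g ∘ suc) r₀ g₀≤a (λ r r≢r₀ → g≤b (suc r) (r≢r₀ ∘ suc-injective))))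

indicator : ∀ {n} → Subset n → ℚ → Fin n → ℚ
indicator (s ∷ S) x zero    = if s then x else 0ℚ
indicator (s ∷ S) x (suc i) = indicator S x i

indicator-∈ : ∀ {n} {S : Subset n} {i} x → i ∈ S → indicator S x i ≡ x
indicator-∈ x here      = refl
indicator-∈ x (there i∈S) = indicator-∈ x i∈S

indicator-∉ : ∀ {n} (S : Subset n) i x → ¬ i ∈ S → indicator S x i ≡ 0ℚ
indicator-∉ (inside ∷ S)  zero    x i∉S = contradiction here i∉S
indicator-∉ (outside ∷ S) zero    x i∉S = refl
indicator-∉ (s ∷ S)       (suc i) x i∉S = indicator-∉ S i x (i∉S ∘ there)

sum-indicator : ∀ {n} (S : Subset n) x → sumℚ n (indicator S x) ≡ ∣ S ∣ · x
sum-indicator []            x = refl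
sum-indicator (inside ∷ S)  x = cong (x +ℚ_) (sum-indicator S x)
sum-indicator (outside ∷ S) x = trans (+-identityˡ _) (sum-indicator S x)

-- If every index satisfying P is hit by one of the k values of h, then at
-- most k indices satisfy P.  (The cover is ℕ-valued so that it can be
-- shifted down along with the indices.)
count≤cover : ∀ N {P : Fin N → Set} (P? : ∀ c → Dec (P c)) k (h : Fin k → ℕ) →
              (∀ c → P c → ∃ λ j → h j ≡ toℕ c) → count N P? ≤ k
count≤cover zero P? k h cover = z≤n
count≤cover (suc N) {P} P? k h cover with P? zero
... | no _ = count≤cover N (P? ∘ suc) k (pred ∘ h) shifted
  where
  shifted : ∀ c → P (suc c) → ∃ λ j → pred (h j) ≡ toℕ c
  shifted c Pc = let (j , hj≡c) = cover (suc c) Pc in j , cong pred hj≡c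
count≤cover (suc N) P? zero    h cover | yes P₀ with cover zero P₀
... | () , _
count≤cover (suc N) {P} P? (suc k) h cover | yes P₀ with cover zero P₀
... | j₀ , hj₀≡0 = s≤s (count≤cover N (P? ∘ suc) k (pred ∘ h ∘ punchIn j₀) shifted)
  where
  -- j₀ only covers index 0, so removing it still covers all later indices.
  shifted : ∀ c → P (suc c) → ∃ λ i → pred (h (punchIn j₀ i)) ≡ toℕ c
  shifted c Pc = punchOut j₀≢j , trans (cong (pred ∘ h) (punchIn-punchOut j₀≢j)) (cong pred hj≡c)
    where
    j = proj₁ (cover (suc c) Pc)
    hj≡c = proj₂ (cover (suc c) Pc)
    j₀≢j : j₀ ≢ j
    j₀≢j refl = 0≢1+n (trans (sym hj₀≡0) hj≡c)

column-determined : ∀ {m k I} {col : I → Fin m → Fin k} {Sym} → IsOAOn m k I col Sym →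
                    ∀ {r r'} → r ≢ r' → ∀ i j →
                    col i r ≡ col j r → col i r' ≡ col j r' → i ≡ j
column-determined {col = col} (in-Sym , pairs-unique) {r} {r'} r≢r' i j eq eq' =
  let (_ , _ , unique) = pairs-unique r r' r≢r' (col i r) (col i r') (in-Sym i r) (in-Sym i r')
  in trans (sym (unique (refl , refl))) (unique (sym eq , sym eq'))

non-σ-column-meets-C :
  ∀ {m k} {J L : Set} {A : J → Fin m → Fin k} → IsOAOn m k J A (λ _ _ → ⊤) →
  ∀ {σ : L → J} {C : Fin m → Fin k} {Sym : Fin m → Fin k → Set} →
  IsOAOn m k (L ⊎ ⊤) [ A ∘ σ , const C ] Sym →
  ∀ c → (∀ j → σ j ≢ c) → ∀ {r r'} → r ≢ r' →
  Sym r (A c r) → Sym r' (A c r') → A c r ≡ C r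
non-σ-column-meets-C {A = A} oa {σ} (_ , pairs-unique) c not-σ {r} {r'} r≢r' s s'
  with pairs-unique r r' r≢r' (A c r) (A c r') s s'
... | inj₁ j  , (eq , eq') , _ = ⊥-elim (not-σ j (column-determined oa r≢r' (σ j) c eq eq'))
... | inj₂ tt , (eq , _)   , _ = sym eq

≤-+-nonneg : ∀ x {y} → 0ℚ ≤ℚ y → x ≤ℚ x +ℚ y
≤-+-nonneg x 0≤y = subst (_≤ℚ x +ℚ _) (+-identityʳ x) (+-mono-≤ (≤-refl {x}) 0≤y)

module Weighting (p : ℕ) where

  q : ℚ
  q = p · 1ℚ

  q² : ℚ
  q² = q *ℚ q

  q³ : ℚ
  q³ = q *ℚ q *ℚ q

  wOut : ℚ
  wOut = - (q² +ℚ - q +ℚ 1ℚ)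

  wS : ℚ
  wS = wOut +ℚ q³

  wC : ℚ
  wC = wOut +ℚ q²

  -- Weight of symbol i in a row with symbol set S and C-entry c: wOut,
  -- plus q³ on S, plus q² - q³ at c.  For c ∈ S this is wC at c, wS on
  -- the rest of S and wOut off S.
  pointWeight : ∀ {n} → Subset n → Fin n → Fin n → ℚ
  pointWeight S c i = wOut +ℚ indicator S q³ i +ℚ indicator ⁅ c ⁆ (q² +ℚ - q³) i

  pointWeight-C : ∀ {n} {S : Subset n} {c i} → c ∈ S → i ≡ c → pointWeight S c i ≡ wC
  pointWeight-C {c = c} c∈S refl =
    trans (cong₂ (λ x y → wOut +ℚ x +ℚ y) (indicator-∈ q³ c∈S) (indicator-∈ _ (x∈⁅x⁆ c)))
          (solve 2 (λ w q → w :+ q :* q :* q :+ (q :* q :+ :- (q :* q :* q)) := w :+ q :* q) refl wOut q)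

  pointWeight-S : ∀ {n} {S : Subset n} {c i} → i ∈ S → i ≢ c → pointWeight S c i ≡ wS
  pointWeight-S {c = c} {i} i∈S i≢c =
    trans (cong₂ (λ x y → wOut +ℚ x +ℚ y) (indicator-∈ q³ i∈S) (indicator-∉ ⁅ c ⁆ i _ (i≢c ∘ x∈⁅y⁆⇒x≡y c)))
          (+-identityʳ wS)

  pointWeight-out : ∀ {n} {S : Subset n} {c i} → c ∈ S → ¬ i ∈ S → pointWeight S c i ≡ wOut
  pointWeight-out {S = S} {c} {i} c∈S i∉S =
    trans (cong₂ (λ x y → wOut +ℚ x +ℚ y) (indicator-∉ S i q³ i∉S) (indicator-∉ ⁅ c ⁆ i _ i∉⁅c⁆))
          (trans (+-identityʳ _) (+-identityʳ wOut))
    where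
    i∉⁅c⁆ : ¬ i ∈ ⁅ c ⁆
    i∉⁅c⁆ i∈⁅c⁆ = i∉S (subst (_∈ S) (sym (x∈⁅y⁆⇒x≡y c i∈⁅c⁆)) c∈S)

  -- A row with p = ∣ S ∣ symbols in S among n = p² has total weight
  -- p²·wOut + p·q³ + (q² - q³) = 0.
  row-sum : (S : Subset (p * p)) (c : Fin (p * p)) → ∣ S ∣ ≡ p →
            sumℚ (p * p) (pointWeight S c) ≡ 0ℚ
  row-sum S c ∣S∣≡p = begin
    sumℚ (p * p) (pointWeight S c)
      ≡⟨ sum-+ (p * p) (λ i → wOut +ℚ indicator S q³ i) (indicator ⁅ c ⁆ (q² +ℚ - q³)) ⟩
    sumℚ (p * p) (λ i → wOut +ℚ indicator S q³ i) +ℚ sumℚ (p * p) (indicator ⁅ c ⁆ (q² +ℚ - q³))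
      ≡⟨ cong₂ _+ℚ_ (sum-+ (p * p) (const wOut) (indicator S q³)) (sum-indicator ⁅ c ⁆ _) ⟩
    sumℚ (p * p) (const wOut) +ℚ sumℚ (p * p) (indicator S q³) +ℚ ∣ ⁅ c ⁆ ∣ · (q² +ℚ - q³)
      ≡⟨ cong₂ (λ x y → x +ℚ y +ℚ ∣ ⁅ c ⁆ ∣ · (q² +ℚ - q³)) (sum-const (p * p) wOut) (sum-indicator S q³) ⟩
    (p * p) · wOut +ℚ ∣ S ∣ · q³ +ℚ ∣ ⁅ c ⁆ ∣ · (q² +ℚ - q³)
      ≡⟨ cong₂ (λ k l → (p * p) · wOut +ℚ k · q³ +ℚ l · (q² +ℚ - q³)) ∣S∣≡p (∣⁅x⁆∣≡1 c) ⟩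
    (p * p) · wOut +ℚ p · q³ +ℚ 1 · (q² +ℚ - q³)
      ≡⟨ cong₂ (λ x y → x +ℚ y +ℚ 1 · (q² +ℚ - q³)) p²·wOut (·-as-* p q³) ⟩
    q² *ℚ wOut +ℚ q *ℚ q³ +ℚ 1 · (q² +ℚ - q³)
      ≡⟨ solve 1 (λ q → q :* q :* (:- (q :* q :+ :- q :+ con 1ℚ)) :+ q :* (q :* q :* q)
                          :+ ((q :* q :+ :- (q :* q :* q)) :+ con 0ℚ) := con 0ℚ) refl q ⟩
    0ℚ ∎
    where
    open Relation.Binary.PropositionalEquality.≡-Reasoning
    p²·wOut : (p * p) · wOut ≡ q² *ℚ wOut
    p²·wOut = trans (·-as-* (p * p) wOut) (cong (_*ℚ wOut) (×1-homo-* p p))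

  one-S-entry : wS +ℚ p · wOut ≡ - 1ℚ
  one-S-entry = trans (cong (wS +ℚ_) (·-as-* p wOut))
    (solve 1 (λ q → (:- (q :* q :+ :- q :+ con 1ℚ)) :+ q :* q :* q :+ q :* (:- (q :* q :+ :- q :+ con 1ℚ))
                    := :- con 1ℚ) refl q)

  one-out-entry-rest-C : wOut +ℚ p · wC ≡ - 1ℚ
  one-out-entry-rest-C = trans (cong (wOut +ℚ_) (·-as-* p wC))
    (solve 1 (λ q → (:- (q :* q :+ :- q :+ con 1ℚ)) :+ q :* ((:- (q :* q :+ :- q :+ con 1ℚ)) :+ q :* q)
                    := :- con 1ℚ) refl q)

  wOut≤wS : wOut ≤ℚ wS
  wOut≤wS = ≤-+-nonneg wOut (subst (0ℚ ≤ℚ_) (trans (×1-homo-* (p * p) p) (cong (_*ℚ q) (×1-homo-* p p)))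
                                   (·1-nonneg (p * p * p)))

  wOut≤wC : wOut ≤ℚ wC
  wOut≤wC = ≤-+-nonneg wOut (subst (0ℚ ≤ℚ_) (×1-homo-* p p) (·1-nonneg (p * p)))

  -- A column x that is not C, and whose entries in the symbol sets S r
  -- are C-entries as soon as two of them lie in the S r, weighs at most -1:
  -- either one entry is in its S r and the others are outside (wS + p·wOut),
  -- or all entries in the S r are C-entries and one entry is outside
  -- (at most wOut + p·wC), or no entry is in its S r (below the first case).
  column-weight-≤-1 : ∀ {n} (S : Fin (suc p) → Subset n) (C : Fin (suc p) → Fin n) →
    (∀ r → C r ∈ S r) → (x : Fin (suc p) → Fin n) → (∃ λ r → x r ≢ C r) →
    (∀ {r r'} → r ≢ r' → x r ∈ S r → x r' ∈ S r' → x r ≡ C r) →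
    sumℚ (suc p) (λ r → pointWeight (S r) (C r) (x r)) ≤ℚ - 1ℚ
  column-weight-≤-1 S C C∈S x (r₀ , x₀≢C₀) meets-C = by-cases (any? (λ r → x r ∈? S r))
    where
    w : Fin (suc p) → ℚ
    w r = pointWeight (S r) (C r) (x r)

    out : ∀ r → ¬ x r ∈ S r → w r ≤ℚ wOut
    out r x∉S = ≤-reflexive (pointWeight-out (C∈S r) x∉S)

    -- Some entry x r₁ lies in S r₁ and is a C-entry: then so is every
    -- entry lying in its symbol set.
    only-C-entries : ∀ r₁ → x r₁ ∈ S r₁ → x r₁ ≡ C r₁ → sumℚ (suc p) w ≤ℚ - 1ℚ
    only-C-entries r₁ x₁∈S x₁≡C₁ =
      subst (sumℚ (suc p) w ≤ℚ_) one-out-entry-rest-C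
        (sum-≤-except p w r₀ (out r₀ (x₀≢C₀ ∘ in-S⇒C r₀)) (λ r _ → ≤wC r))
      where
      in-S⇒C : ∀ r → x r ∈ S r → x r ≡ C r
      in-S⇒C r x∈S with r ≟ r₁
      ... | yes refl = x₁≡C₁
      ... | no r≢r₁  = meets-C r≢r₁ x∈S x₁∈S
      ≤wC : ∀ r → w r ≤ℚ wC
      ≤wC r with x r ∈? S r
      ... | yes x∈S = ≤-reflexive (pointWeight-C (C∈S r) (in-S⇒C r x∈S))
      ... | no x∉S  = ≤-trans (out r x∉S) wOut≤wC

    -- Some entry x r₁ lies in S r₁ but is not a C-entry: then it is the
    -- only entry lying in its symbol set.
    single-S-entry : ∀ r₁ → x r₁ ∈ S r₁ → x r₁ ≢ C r₁ → sumℚ (suc p) w ≤ℚ - 1ℚ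
    single-S-entry r₁ x₁∈S x₁≢C₁ =
      subst (sumℚ (suc p) w ≤ℚ_) one-S-entry
        (sum-≤-except p w r₁ (≤-reflexive (pointWeight-S x₁∈S x₁≢C₁))
          (λ r r≢r₁ → out r (λ x∈S → x₁≢C₁ (meets-C (r≢r₁ ∘ sym) x₁∈S x∈S))))

    by-cases : Dec (∃ λ r → x r ∈ S r) → sumℚ (suc p) w ≤ℚ - 1ℚ
    by-cases (yes (r₁ , x₁∈S)) with x r₁ ≟ C r₁
    ... | yes x₁≡C₁ = only-C-entries r₁ x₁∈S x₁≡C₁
    ... | no x₁≢C₁  = single-S-entry r₁ x₁∈S x₁≢C₁
    by-cases (no none-in-S) =
      subst (sumℚ (suc p) w ≤ℚ_) one-S-entry
        (sum-≤-except p w zero (≤-trans (out zero (none-in-S ∘ (zero ,_))) wOut≤wS)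
          (λ r _ → out r (none-in-S ∘ (r ,_))))

lemma14 : (m : ℕ) → 3 ≤ m →
    (A : Fin (((m ∸ 1) * (m ∸ 1)) * ((m ∸ 1) * (m ∸ 1))) → Fin m → Fin ((m ∸ 1) * (m ∸ 1))) →
    IsOA m ((m ∸ 1) * (m ∸ 1)) A →
    (σ : Fin ((m ∸ 1) * (m ∸ 1) ∸ 1) → Fin (((m ∸ 1) * (m ∸ 1)) * ((m ∸ 1) * (m ∸ 1)))) →
    Injective _≡_ _≡_ σ →
    (Sr : Fin m → Subset ((m ∸ 1) * (m ∸ 1))) →
    (∀ r → ∣ Sr r ∣ ≡ m ∸ 1) →
    (C : Fin m → Fin ((m ∸ 1) * (m ∸ 1))) →
    (∀ r → C r ∈ Sr r) →
    IsOAOn m ((m ∸ 1) * (m ∸ 1)) (Fin ((m ∸ 1) * (m ∸ 1) ∸ 1) ⊎ ⊤)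
    [ A ∘ σ , const C ] (λ r a → a ∈ Sr r) →
    (∀ j → ¬ (∀ r → A j r ≡ C r)) →
    ¬ MMSStar m ((m ∸ 1) * (m ∸ 1)) (((m ∸ 1) * (m ∸ 1)) * ((m ∸ 1) * (m ∸ 1))) A
lemma14 zero ()
lemma14 (suc zero) (s≤s ())
lemma14 (suc (suc zero)) (s≤s (s≤s ()))
lemma14 m@(suc p@(suc (suc _))) _ A isOA σ _ Sr ∣Sr∣≡p C C∈S extension C∉A mms =
  <-irrefl refl (≤ℕ-trans (mms weight total-zero) nonneg≤n-1)
  where
  open Weighting p

  weight : Fin m → Fin (p * p) → ℚ
  weight r = pointWeight (Sr r) (C r)

  total-zero : totalWeight m (p * p) weight ≡ 0ℚ
  total-zero = sum-zero m (λ r → row-sum (Sr r) (C r) (∣Sr∣≡p r))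

  non-σ-negative : ∀ c → (∀ j → σ j ≢ c) → colWeight A weight c ≤ℚ - 1ℚ
  non-σ-negative c not-σ =
    column-weight-≤-1 Sr C C∈S (A c) (¬∀⟶∃¬ m _ (λ r → A c r ≟ C r) (C∉A c))
      (non-σ-column-meets-C isOA extension c not-σ)

  nonneg⇒σ : ∀ c → 0ℚ ≤ℚ colWeight A weight c → ∃ λ j → toℕ (σ j) ≡ toℕ c
  nonneg⇒σ c 0≤w with any? (λ j → σ j ≟ c)
  ... | yes (j , σj≡c) = j , cong toℕ σj≡c
  ... | no not-σ       = contradiction (≤-trans 0≤w (non-σ-negative c (λ j → not-σ ∘ (j ,_)))) 0≰-1

  nonneg≤n-1 : count (p * p * (p * p)) (λ c → 0ℚ ≤ℚ? colWeight A weight c) ≤ p * p ∸ 1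
  nonneg≤n-1 = count≤cover _ (λ c → 0ℚ ≤ℚ? colWeight A weight c) (p * p ∸ 1) (toℕ ∘ σ) nonneg⇒σ
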